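{- Let $k \geq 2$ and let $\lambda_1, \ldots, \lambda_k$ be nonzero integers with $\gcd(\lambda_1, \ldots, \lambda_k) = 1$. For $1 \le i \le k$ let $g_i = \gcd(\lambda_1, \ldots, \lambda_{i-1}, \lambda_{i+1}, \ldots, \lambda_k)$, and let $p = \prod_{i=1}^k g_i$. Let $A \subset \mathbb{Z}$ be a finite reduced set. For each $i$, write $$A = \bigcup_{j=1}^{m_i} A_{ij}, \qquad A_{ij} = a_{ij} + g_i \cdot A'_{ij}, \quad A_{ij} \neq \emptyset, \quad 0 \le a_{ij} < g_i,$$ a disjoint union according to residue classes mod $g_i$, and similarly write $$A = \bigcup_{e=1}^{m} P_e, \qquad P_e = p_e + p \cdot P'_e, \quad P_e \ne \emptyset, \quad 0 \le p_e < p,$$ a disjoint union according to residue classes mod $p$. For $1\le e\le m$ and $1 \le i \le k$ let $e_i \in \{1, \ldots, m_i\}$ be the index with $p_e \equiv a_{i e_i} \pmod{g_i}$ (so $P_e \subset A_{ie_i}$). Fix $1 \le e \le m$ and suppose that for all $1 \le i \le k$ the set $A'_{ie_i}$ is fully distributed mod $g_i$. Then either $P'_e$ is fully distributed mod $g_i$ for all $1 \le i \le k$, or $$|\lambda_1 \cdot A_{1e_1} + \ldots + \lambda_k \cdot A_{ke_k}| \geq |\lambda_1 \cdot P_e + \ldots + \lambda_k \cdot P_e| + |P_e|.$$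
   Context: For finite $X, Y \subset \mathbb{Z}$, $X+Y = \{x+y : x\in X, y \in Y\}$, $d \cdot X = \{dx : x \in X\}$, and $c + X = \{c + x : x \in X\}$. A set is fully distributed mod $q$ if it intersects every residue class mod $q$. A finite set $A \subset \mathbb{Z}$ is reduced if it is not contained in any proper infinite arithmetic progression, i.e. the differences of elements of $A$ have greatest common divisor $1$. -}

module Defs where

open import Data.Nat as ℕ using (ℕ; zero; suc)
import Data.Nat.GCD as ℕG
open import Data.Nat.Divisibility using (_∣?_)
open import Data.Integer as ℤ using (ℤ; +_; ∣_∣; _-_)
open import Data.Integer.DivMod using (_/ℕ_; _%ℕ_)
open import Data.List using (List; []; _∷_; map; foldr; filter; length; deduplicate; cartesianProductWith; allFin)
open import Data.List.Membership.Propositional using (_∈_)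
open import Data.Fin using (Fin)
import Data.Fin as Fin
open import Data.Product using (∃; _×_; _,_)
open import Relation.Nullary using (¬?)
open import Relation.Binary.PropositionalEquality using (_≡_)

-- Finite sets of integers are represented by lists (duplicates allowed);
-- the cardinality |X| counts distinct elements.
card : List ℤ → ℕ
card X = length (deduplicate ℤ._≟_ X)

_⊕_ : List ℤ → List ℤ → List ℤ
X ⊕ Y = cartesianProductWith ℤ._+_ X Y

_·_ : ℤ → List ℤ → List ℤ
d · X = map (d ℤ.*_) X

bigSum : List (List ℤ) → List ℤ
bigSum = foldr _⊕_ (+ 0 ∷ [])

_≡[mod_]_ : ℤ → ℕ → ℤ → Set
x ≡[mod q ] y = q Data.Nat.Divisibility.∣ ∣ x - y ∣
  where import Data.Nat.Divisibility

FullyDistributed : ℕ → List ℤ → Set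
FullyDistributed q X = ∀ (r : ℤ) → ∃ λ x → x ∈ X × x ≡[mod q ] r

-- reduced: the gcd of all differences of elements of A is 1
-- (unfolded: every common divisor of all differences equals 1)
Reduced : List ℤ → Set
Reduced A = ∀ (d : ℕ) → (∀ x y → x ∈ A → y ∈ A → d Data.Nat.Divisibility.∣ ∣ x - y ∣) → d ≡ 1
  where import Data.Nat.Divisibility

gcdList : List ℤ → ℕ
gcdList = foldr (λ x g → ℕG.gcd ∣ x ∣ g) 0

gᵢ : ∀ {k} → (Fin k → ℤ) → Fin k → ℕ
gᵢ {k} lam i = gcdList (map lam (filter (λ j → ¬? (j Fin.≟ i)) (allFin k)))

pOf : ∀ {k} → (Fin k → ℤ) → ℕ
pOf {k} lam = foldr ℕ._*_ 1 (map (gᵢ lam) (allFin k))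

classOf : ℕ → ℤ → List ℤ → List ℤ
classOf q r A = filter (λ x → q ∣? ∣ x - r ∣) A

-- least nonnegative residue of r mod q (convention: r itself if q = 0; irrelevant here)
resid : ℤ → ℕ → ℤ
resid r zero = r
resid r (suc n) = + (r %ℕ suc n)

-- exact division by q (convention: 0 if q = 0; irrelevant here since q ≥ 1)
divBy : ℤ → ℕ → ℤ
divBy x zero = + 0
divBy x (suc n) = x /ℕ suc n

-- For the class C = a + q · C' with 0 ≤ a < q, where a ≡ r (mod q): returns C'
primeOf : ℕ → ℤ → List ℤ → List ℤ
primeOf q r C = map (λ x → divBy (x - resid r q) q) C

module Submission where

-- Let P' miss the residue r modulo g = gᵢ.  Since g ∣ λⱼ for j ≠ i, gcd(g, λᵢ) = 1 and
-- p = g Q with gcd(g, Q) = 1, the full distribution of G'ᵢ yields x ∈ Gᵢ with g² ∤ λᵢ (x − y) for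
-- every y ∈ P (x is "separated" from P).  Modulo g², every element Σ λⱼ dⱼ (dⱼ ∈ P) of the small
-- sumset depends only on its i-th summand, so fixing j₀ ≠ i and y₀ ∈ P the |P| sums
-- λᵢ x + λⱼ₀ y + Σ_{j ≠ i, j₀} λⱼ y₀  (y ∈ P) are distinct, avoid λ₁·P + … + λₖ·P, and together with
-- it lie in λ₁·G₁ + … + λₖ·Gₖ.

open import Defs
open import Data.Nat using (ℕ; zero; suc; _≥_)
import Data.Nat as ℕ
open import Data.Nat.Divisibility as ℕ∣ using (_∣?_) renaming (_∣_ to _∣ₙ_)
import Data.Nat.Properties as ℕP
open import Data.Nat.GCD using (gcd[m,n]∣m; gcd[m,n]∣n; gcd-greatest)
open import Data.Nat.Coprimality using (Coprime; coprime-divisor)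
open import Data.Integer as ℤ using (ℤ; +_; ∣_∣; _-_; _+_; _*_; -_; _<_)
import Data.Integer.Properties as ℤP
open import Data.Integer.DivMod using (_/ℕ_; _%ℕ_; a≡a%ℕn+[a/ℕn]*n; n%ℕd<d)
open import Data.Integer.Divisibility.Signed as ℤ∣ using (_∣_; divides)
open import Data.Integer.Tactic.RingSolver using (solve-∀)
open import Data.List using (List; []; _∷_; map; foldr; length; allFin; _++_; deduplicate)
import Data.List.Properties as ListP
open import Data.List.Membership.Propositional using (_∈_; _∉_; find; lose)
open import Data.List.Membership.Propositional.Properties
open import Data.List.Relation.Unary.Any using (here; there; any?)
open import Data.List.Relation.Unary.Unique.Propositional using (Unique)
import Data.List.Relation.Unary.AllPairs as AllPairs
import Data.List.Relation.Unary.Unique.Propositional.Properties as UniqueP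
open import Data.List.Relation.Unary.Unique.DecPropositional.Properties ℤ._≟_ using (deduplicate-!)
open import Data.Fin as Fin using (Fin)
open import Data.Fin.Properties using (toℕ-fromℕ<)
open import Data.Product using (∃; _×_; _,_; proj₂; Σ)
open import Data.Sum as Sum using (_⊎_; inj₁; inj₂)
open import Data.Empty using (⊥-elim)
open import Function using (_∘_)
open import Relation.Nullary using (¬_; Dec; yes; no; ¬?)
open import Relation.Nullary.Decidable using (toSum)
open import Relation.Binary.PropositionalEquality
open ≡-Reasoning

∣ₙ⇒∣ : ∀ {q z} → q ∣ₙ ∣ z ∣ → + q ∣ z
∣ₙ⇒∣ = ℤ∣.∣ᵤ⇒∣

∣⇒∣ₙ : ∀ {q z} → + q ∣ z → q ∣ₙ ∣ z ∣
∣⇒∣ₙ = ℤ∣.∣⇒∣ᵤ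

∣-sub-sym : ∀ {M} a b → M ∣ a - b → M ∣ b - a
∣-sub-sym a b M∣a-b = subst (_ ∣_) (negate a b) (ℤ∣.∣m⇒∣-m M∣a-b)
  where
  negate : ∀ a b → - (a - b) ≡ b - a
  negate = solve-∀

∣-sub-trans : ∀ {M} a b c → M ∣ a - b → M ∣ b - c → M ∣ a - c
∣-sub-trans a b c M∣a-b M∣b-c = subst (_ ∣_) (telescope a b c) (ℤ∣.∣m∣n⇒∣m+n M∣a-b M∣b-c)
  where
  telescope : ∀ a b c → (a - b) + (b - c) ≡ a - c
  telescope = solve-∀

resid-congruent : ∀ r q → q ≢ 0 → + q ∣ r - resid r q
resid-congruent r zero q≢0 = ⊥-elim (q≢0 refl)
resid-congruent r (suc n) _ = divides (r /ℕ suc n) (begin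
  r - ρ                           ≡⟨ cong (_- ρ) (a≡a%ℕn+[a/ℕn]*n r (suc n)) ⟩
  (ρ + r /ℕ suc n * + suc n) - ρ  ≡⟨ cancel ρ _ ⟩
  r /ℕ suc n * + suc n            ∎)
  where
  ρ = + (r %ℕ suc n)
  cancel : ∀ a b → (a + b) - a ≡ b
  cancel = solve-∀

small-multiple≡0 : ∀ (w : ℤ) {q m : ℕ} → m ℕ.< q → + m ≡ w * + q → w ≡ + 0
small-multiple≡0 w {q} {m} m<q m≡wq with ∣ w ∣ ℕ.≟ 0
... | yes ∣w∣≡0 = ℤP.∣i∣≡0⇒i≡0 ∣w∣≡0
... | no ∣w∣≢0 = ⊥-elim (ℕP.<⇒≱ m<q q≤m)
  where
  q≤m : q ℕ.≤ m
  q≤m = subst (q ℕ.≤_) (sym (trans (cong ∣_∣ m≡wq) (ℤP.abs-* w (+ q))))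
          (ℕP.m≤n*m q ∣ w ∣ {{ℕ.≢-nonZero ∣w∣≢0}})

divBy-exact : ∀ z q → q ≢ 0 → + q ∣ z → z ≡ divBy z q * + q
divBy-exact z zero q≢0 _ = ⊥-elim (q≢0 refl)
divBy-exact z (suc n) _ (divides m z≡mq) = trans z≡mq (cong (_* q) m≡d)
  where
  q = + suc n
  d = z /ℕ suc n
  -- the remainder of z = m q is (m − d) q, a multiple of q below q
  remainder : + (z %ℕ suc n) ≡ (m - d) * q
  remainder = begin
    + (z %ℕ suc n)                   ≡⟨ sym (cancel (+ (z %ℕ suc n)) (d * q)) ⟩
    (+ (z %ℕ suc n) + d * q) - d * q ≡⟨ cong (_- d * q) (sym (a≡a%ℕn+[a/ℕn]*n z (suc n))) ⟩
    z - d * q                        ≡⟨ cong (_- d * q) z≡mq ⟩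
    m * q - d * q                    ≡⟨ factor m d q ⟩
    (m - d) * q                      ∎
    where
    cancel : ∀ a b → (a + b) - b ≡ a
    cancel = solve-∀
    factor : ∀ a b c → a * c - b * c ≡ (a - b) * c
    factor = solve-∀
  m≡d : m ≡ d
  m≡d = ℤP.i-j≡0⇒i≡j m d (small-multiple≡0 (m - d) (n%ℕd<d z (suc n)) remainder)

-- The coordinate of z in the residue class of r modulo q: writing the class as a + q·ℤ with
-- a the least residue of r, z = a + q · coord q r z.  By definition primeOf q r = map (coord q r).
coord : ℕ → ℤ → ℤ → ℤ
coord q r z = divBy (z - resid r q) q

coord-difference : ∀ q r z → q ≢ 0 → + q ∣ z - r → z - r ≡ (coord q r z - coord q r r) * + q
coord-difference q r z q≢0 q∣z-r = begin
  z - r                                  ≡⟨ sym (telescope z r a) ⟩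
  (z - a) - (r - a)                      ≡⟨ cong₂ _-_ (divBy-exact _ q q≢0 q∣z-a) (divBy-exact _ q q≢0 q∣r-a) ⟩
  coord q r z * + q - coord q r r * + q  ≡⟨ factor (coord q r z) (coord q r r) (+ q) ⟩
  (coord q r z - coord q r r) * + q      ∎
  where
  a = resid r q
  q∣r-a = resid-congruent r q q≢0
  q∣z-a = ∣-sub-trans z r a q∣z-r q∣r-a
  telescope : ∀ z r a → (z - a) - (r - a) ≡ z - r
  telescope = solve-∀
  factor : ∀ a b c → a * c - b * c ≡ (a - b) * c
  factor = solve-∀

coprime-cancel : ∀ {g} a z → Coprime g ∣ a ∣ → + g ∣ a * z → + g ∣ z
coprime-cancel a z cop g∣az = ∣ₙ⇒∣ (coprime-divisor cop (subst (_ ∣ₙ_) (ℤP.abs-* a z) (∣⇒∣ₙ g∣az)))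

square-∣-product : ∀ {g} a b → + g ∣ a → + g ∣ b → + g * + g ∣ a * b
square-∣-product {g} _ _ (divides qa refl) (divides qb refl) = divides (qa * qb) (regroup qa qb (+ g))
  where
  regroup : ∀ x y z → (x * z) * (y * z) ≡ (x * y) * (z * z)
  regroup = solve-∀

square-separation : ∀ {g Q : ℕ} (lam w r v : ℤ) → g ≢ 0 → Coprime g ∣ lam ∣ → Coprime g Q →
  + g ∣ w - + Q * (r - v) → + g * + g ∣ lam * (w * + g) → + g ∣ v - r
square-separation {g} {Q} lam w r v g≢0 cop-lam cop-Q g∣w-Q[r-v] g²∣ =
  ∣-sub-sym r v (coprime-cancel (+ Q) (r - v) cop-Q g∣Q[r-v])
  where
  g∣lam*w : + g ∣ lam * w
  g∣lam*w = ℤ∣.*-cancelʳ-∣ (+ g) {{ℤ.≢-nonZero {+ g} (g≢0 ∘ cong ∣_∣)}}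
              (subst (+ g * + g ∣_) (sym (ℤP.*-assoc lam w (+ g))) g²∣)
  g∣Q[r-v] : + g ∣ + Q * (r - v)
  g∣Q[r-v] = subst (+ g ∣_) (cancel w (+ Q * (r - v)))
               (ℤ∣.∣m∣n⇒∣m-n (coprime-cancel lam w cop-lam g∣lam*w) g∣w-Q[r-v])
    where
    cancel : ∀ a b → a - (a - b) ≡ b
    cancel = solve-∀

gcdList-∣ : ∀ (L : List ℤ) {x} → x ∈ L → gcdList L ∣ₙ ∣ x ∣
gcdList-∣ (y ∷ L) (here refl) = gcd[m,n]∣m ∣ y ∣ (gcdList L)
gcdList-∣ (y ∷ L) (there x∈L) = ℕ∣.∣-trans (gcd[m,n]∣n ∣ y ∣ (gcdList L)) (gcdList-∣ L x∈L)

∣-gcdList : ∀ d (L : List ℤ) → (∀ {x} → x ∈ L → d ∣ₙ ∣ x ∣) → d ∣ₙ gcdList L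
∣-gcdList d [] _ = d ℕ∣.∣0
∣-gcdList d (y ∷ L) d∣L = gcd-greatest (d∣L (here refl)) (∣-gcdList d L (d∣L ∘ there))

prodL : {I : Set} → (I → ℕ) → List I → ℕ
prodL f L = foldr ℕ._*_ 1 (map f L)

∣-prodL : ∀ {I} (f : I → ℕ) {L j} → j ∈ L → f j ∣ₙ prodL f L
∣-prodL f {_ ∷ L} (here refl) = ℕ∣.m∣m*n (prodL f L)
∣-prodL f {x ∷ _} (there j∈L) = ℕ∣.∣n⇒∣m*n (f x) (∣-prodL f j∈L)

prodL≢0 : ∀ {I} (f : I → ℕ) L → (∀ j → f j ≢ 0) → prodL f L ≢ 0
prodL≢0 f [] _ ()
prodL≢0 f (j ∷ L) f≢0 fjΠ≡0 with ℕP.m*n≡0⇒m≡0∨n≡0 (f j) fjΠ≡0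
... | inj₁ fj≡0 = f≢0 j fj≡0
... | inj₂ Π≡0 = prodL≢0 f L f≢0 Π≡0

coprime-* : ∀ {a b c} → Coprime a b → Coprime a c → Coprime a (b ℕ.* c)
coprime-* ab ac (d∣a , d∣bc) = ac (d∣a , coprime-divisor (λ (e∣d , e∣b) → ab (ℕ∣.∣-trans e∣d d∣a , e∣b)) d∣bc)

coprime-prodL : ∀ {I} (f : I → ℕ) {a} L → (∀ {j} → j ∈ L → Coprime a (f j)) → Coprime a (prodL f L)
coprime-prodL f [] _ (_ , d∣1) = ℕ∣.∣1⇒≡1 d∣1
coprime-prodL f (j ∷ L) cop = coprime-* (cop (here refl)) (coprime-prodL f L (cop ∘ there))

prodL-split : ∀ {I} (f : I → ℕ) {i} L → Unique L → i ∈ L → (∀ {j} → j ≢ i → Coprime (f i) (f j)) →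
  ∃ λ Q → prodL f L ≡ f i ℕ.* Q × Coprime (f i) Q
prodL-split f (_ ∷ L) u (here refl) cop =
  prodL f L , refl , coprime-prodL f L (λ j∈L → cop (λ { refl → UniqueP.Unique[x∷xs]⇒x∉xs u j∈L }))
prodL-split f {i} (j ∷ L) u@(_ AllPairs.∷ uL) (there i∈L) cop with prodL-split f L uL i∈L cop
... | Q , Π≡fiQ , copQ = f j ℕ.* Q , Π≡ , coprime-* (cop j≢i) copQ
  where
  j≢i : j ≢ i
  j≢i refl = UniqueP.Unique[x∷xs]⇒x∉xs u i∈L
  Π≡ : f j ℕ.* prodL f L ≡ f i ℕ.* (f j ℕ.* Q)
  Π≡ = begin
    f j ℕ.* prodL f L       ≡⟨ cong (f j ℕ.*_) Π≡fiQ ⟩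
    f j ℕ.* (f i ℕ.* Q)     ≡⟨ ℕP.*-assoc (f j) (f i) Q ⟨
    (f j ℕ.* f i) ℕ.* Q     ≡⟨ cong (ℕ._* Q) (ℕP.*-comm (f j) (f i)) ⟩
    (f i ℕ.* f j) ℕ.* Q     ≡⟨ ℕP.*-assoc (f i) (f j) Q ⟩
    f i ℕ.* (f j ℕ.* Q)     ∎

sumL : {I : Set} → (I → ℤ) → List I → ℤ
sumL f [] = + 0
sumL f (j ∷ L) = f j + sumL f L

sumL-cong : ∀ {I} {f f' : I → ℤ} L → (∀ {j} → j ∈ L → f j ≡ f' j) → sumL f L ≡ sumL f' L
sumL-cong [] _ = refl
sumL-cong (j ∷ L) f≡f' = cong₂ _+_ (f≡f' (here refl)) (sumL-cong L (f≡f' ∘ there))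

sums-congruent : ∀ {I} M (f f' : I → ℤ) L → (∀ {j} → j ∈ L → M ∣ f j - f' j) →
  M ∣ sumL f L - sumL f' L
sums-congruent M f f' [] _ = divides (+ 0) refl
sums-congruent M f f' (j ∷ L) M∣ = subst (M ∣_) (sym (regroup-difference (f j) (f' j) _ _))
  (ℤ∣.∣m∣n⇒∣m+n (M∣ (here refl)) (sums-congruent M f f' L (M∣ ∘ there)))
  where
  regroup-difference : ∀ a b s t → (a + s) - (b + t) ≡ (a - b) + (s - t)
  regroup-difference = solve-∀

sums-congruent-except : ∀ {I} M (f f' : I → ℤ) {i} L → Unique L → i ∈ L →
  (∀ {j} → j ∈ L → j ≢ i → M ∣ f j - f' j) → M ∣ (sumL f L - sumL f' L) - (f i - f' i)
sums-congruent-except M f f' (j ∷ L) u (here refl) M∣ =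
  subst (M ∣_) (drop-head (f j) (f' j) _ _)
    (sums-congruent M f f' L (λ j'∈L → M∣ (there j'∈L) λ { refl → UniqueP.Unique[x∷xs]⇒x∉xs u j'∈L }))
  where
  drop-head : ∀ a b s t → s - t ≡ ((a + s) - (b + t)) - (a - b)
  drop-head = solve-∀
sums-congruent-except M f f' {i} (j ∷ L) u@(_ AllPairs.∷ uL) (there i∈L) M∣ =
  subst (M ∣_) (add-head (f j) (f' j) _ _ (f i - f' i))
    (ℤ∣.∣m∣n⇒∣m+n (M∣ (here refl) (λ { refl → UniqueP.Unique[x∷xs]⇒x∉xs u i∈L }))
                  (sums-congruent-except M f f' L uL i∈L (M∣ ∘ there)))
  where
  add-head : ∀ a b s t d → (a - b) + ((s - t) - d) ≡ ((a + s) - (b + t)) - d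
  add-head = solve-∀

equal-sums-congruent-at : ∀ {I} M (f f' : I → ℤ) {i} L → Unique L → i ∈ L →
  (∀ {j} → j ∈ L → j ≢ i → M ∣ f j - f' j) → sumL f L ≡ sumL f' L → M ∣ f i - f' i
equal-sums-congruent-at M f f' {i} L u i∈L M∣ Σ≡Σ' = subst (M ∣_) (ℤP.neg-involutive d) (ℤ∣.∣m⇒∣-m M∣-d)
  where
  d = f i - f' i
  M∣-d : M ∣ - d
  M∣-d = subst (M ∣_) (ℤP.+-identityˡ (- d))
           (subst (λ z → M ∣ z - d) (ℤP.i≡j⇒i-j≡0 Σ≡Σ') (sums-congruent-except M f f' L u i∈L M∣))

sumset : ∀ {k} → (Fin k → ℤ) → (Fin k → List ℤ) → List (Fin k) → List ℤ
sumset lam X L = bigSum (map (λ j → lam j · X j) L)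

upd : ∀ {k} → (Fin k → ℤ) → Fin k → ℤ → Fin k → ℤ
upd d j x j' with j' Fin.≟ j
... | yes _ = x
... | no _ = d j'

upd-eq : ∀ {k} (d : Fin k → ℤ) j x → upd d j x j ≡ x
upd-eq d j x with j Fin.≟ j
... | yes _ = refl
... | no j≢j = ⊥-elim (j≢j refl)

upd-neq : ∀ {k} (d : Fin k → ℤ) j x {j'} → j' ≢ j → upd d j x j' ≡ d j'
upd-neq d j x {j'} j'≢j with j' Fin.≟ j
... | yes j'≡j = ⊥-elim (j'≢j j'≡j)
... | no _ = refl

sumset-∈⁺ : ∀ {k} (lam : Fin k → ℤ) (X : Fin k → List ℤ) (d : Fin k → ℤ) L →
  (∀ {j} → j ∈ L → d j ∈ X j) → sumL (λ j → lam j * d j) L ∈ sumset lam X L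
sumset-∈⁺ lam X d [] _ = here refl
sumset-∈⁺ lam X d (j ∷ L) d∈X =
  ∈-cartesianProductWith⁺ _+_ (∈-map⁺ (lam j *_) (d∈X (here refl))) (sumset-∈⁺ lam X d L (d∈X ∘ there))

sumset-∈⁻ : ∀ {k} (lam : Fin k → ℤ) (X : Fin k → List ℤ) L {z} → Unique L → z ∈ sumset lam X L →
  Σ (Fin k → ℤ) λ d → (∀ {j} → j ∈ L → d j ∈ X j) × z ≡ sumL (λ j → lam j * d j) L
sumset-∈⁻ lam X [] _ (here refl) = (λ _ → + 0) , (λ ()) , refl
sumset-∈⁻ lam X (j ∷ L) u@(_ AllPairs.∷ uL) z∈
  with _ , _ , a∈ , b∈ , refl ← ∈-cartesianProductWith⁻ _+_ (lam j · X j) (sumset lam X L) z∈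
  with x , x∈X , refl ← ∈-map⁻ (lam j *_) a∈
  with d , d∈X , refl ← sumset-∈⁻ lam X L uL b∈
  = upd d j x , upd∈X , cong₂ _+_ (cong (lam j *_) (sym (upd-eq d j x)))
                                  (sumL-cong L (λ j'∈L → cong (lam _ *_) (sym (upd-neq d j x (≢j j'∈L)))))
  where
  ≢j : ∀ {j'} → j' ∈ L → j' ≢ j
  ≢j j'∈L refl = UniqueP.Unique[x∷xs]⇒x∉xs u j'∈L
  upd∈X : ∀ {j'} → j' ∈ j ∷ L → upd d j x j' ∈ X j'
  upd∈X (here refl) = subst (_∈ X j) (sym (upd-eq d j x)) x∈X
  upd∈X {j'} (there j'∈L) = subst (_∈ X j') (sym (upd-neq d j x (≢j j'∈L))) (d∈X j'∈L)

remove : ℤ → List ℤ → List ℤ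
remove u [] = []
remove u (x ∷ X) with x ℤ.≟ u
... | yes _ = X
... | no _ = x ∷ remove u X

length-remove : ∀ {u} X → u ∈ X → suc (length (remove u X)) ≡ length X
length-remove {u} (x ∷ X) u∈ with x ℤ.≟ u | u∈
... | yes _ | _ = refl
... | no x≢u | here u≡x = ⊥-elim (x≢u (sym u≡x))
... | no _ | there u∈X = cong suc (length-remove X u∈X)

∈-remove : ∀ {u z} X → z ∈ X → z ≢ u → z ∈ remove u X
∈-remove {u} (x ∷ X) z∈ z≢u with x ℤ.≟ u | z∈
... | yes refl | here refl = ⊥-elim (z≢u refl)
... | yes _ | there z∈X = z∈X
... | no _ | here z≡x = here z≡x
... | no _ | there z∈X = there (∈-remove X z∈X z≢u)

unique⊆⇒length≤ : ∀ U X → Unique U → (∀ {z} → z ∈ U → z ∈ X) → length U ℕ.≤ length X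
unique⊆⇒length≤ [] X _ _ = ℕ.z≤n
unique⊆⇒length≤ (x ∷ U) X u@(_ AllPairs.∷ uU) U⊆X =
  subst (suc (length U) ℕ.≤_) (length-remove X (U⊆X (here refl)))
    (ℕ.s≤s (unique⊆⇒length≤ U (remove x X) uU
      (λ z∈U → ∈-remove X (U⊆X (there z∈U)) λ { refl → UniqueP.Unique[x∷xs]⇒x∉xs u z∈U })))

unique⊆⇒length≤card : ∀ U X → Unique U → (∀ {z} → z ∈ U → z ∈ X) → length U ℕ.≤ card X
unique⊆⇒length≤card U X u U⊆X = unique⊆⇒length≤ U _ u (∈-deduplicate⁺ ℤ._≟_ ∘ U⊆X)

card-disjoint-image : ∀ (S T P : List ℤ) (f : ℤ → ℤ) → (∀ {y y'} → f y ≡ f y' → y ≡ y') →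
  (∀ {z} → z ∈ S → z ∈ T) → (∀ {y} → y ∈ P → f y ∈ T) → (∀ {y} → y ∈ P → f y ∉ S) →
  card T ℕ.≥ card S ℕ.+ card P
card-disjoint-image S T P f f-inj S⊆T fP⊆T fP∩S=∅ =
  subst (ℕ._≤ card T) length≡ (unique⊆⇒length≤card (S₀ ++ fP₀) T unique ⊆T)
  where
  S₀ = deduplicate ℤ._≟_ S
  P₀ = deduplicate ℤ._≟_ P
  fP₀ = map f P₀
  disjoint : ∀ {z} → ¬ (z ∈ S₀ × z ∈ fP₀)
  disjoint (z∈S₀ , z∈fP₀) with y , y∈P₀ , refl ← ∈-map⁻ f z∈fP₀ =
    fP∩S=∅ (∈-deduplicate⁻ ℤ._≟_ P y∈P₀) (∈-deduplicate⁻ ℤ._≟_ S z∈S₀)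
  unique : Unique (S₀ ++ fP₀)
  unique = UniqueP.++⁺ (deduplicate-! S) (UniqueP.map⁺ f-inj (deduplicate-! P)) disjoint
  ⊆T : ∀ {z} → z ∈ S₀ ++ fP₀ → z ∈ T
  ⊆T z∈ with ∈-++⁻ S₀ z∈
  ... | inj₁ z∈S₀ = S⊆T (∈-deduplicate⁻ ℤ._≟_ S z∈S₀)
  ... | inj₂ z∈fP₀ with y , y∈P₀ , refl ← ∈-map⁻ f z∈fP₀ = fP⊆T (∈-deduplicate⁻ ℤ._≟_ P y∈P₀)
  length≡ : length (S₀ ++ fP₀) ≡ card S ℕ.+ card P
  length≡ = trans (ListP.length-++ S₀) (cong (card S ℕ.+_) (ListP.length-map f P₀))

all-or-witness : ∀ {k} {X Y : Fin k → Set} → (∀ i → X i ⊎ Y i) → (∀ i → X i) ⊎ ∃ Y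
all-or-witness {zero} _ = inj₁ λ ()
all-or-witness {suc k} {X} dich with dich Fin.zero | all-or-witness (dich ∘ Fin.suc)
... | inj₂ y | _ = inj₂ (Fin.zero , y)
... | inj₁ _ | inj₂ (i , y) = inj₂ (Fin.suc i , y)
... | inj₁ x | inj₁ xs = inj₁ all
  where
  all : ∀ i → X i
  all Fin.zero = x
  all (Fin.suc i) = xs i

fd-dichotomy : ∀ q (X : List ℤ) → q ≢ 0 →
  FullyDistributed q X ⊎ ∃ λ r → ∀ {v} → v ∈ X → ¬ + q ∣ v - r
fd-dichotomy zero _ q≢0 = ⊥-elim (q≢0 refl)
fd-dichotomy (suc n) X _
  with all-or-witness (λ (ρ : Fin (suc n)) → toSum (any? (λ v → suc n ∣? ∣ v - + Fin.toℕ ρ ∣) X))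
... | inj₂ (ρ , missed) = inj₂ (+ Fin.toℕ ρ , λ v∈X q∣ → missed (lose v∈X (∣⇒∣ₙ q∣)))
... | inj₁ hit = inj₁ fd
  where
  -- every r meets X through its least residue ρ
  fd : FullyDistributed (suc n) X
  fd r with v , v∈X , q∣v-ρ ← find (hit (Fin.fromℕ< (n%ℕd<d r (suc n)))) =
    v , v∈X , ∣⇒∣ₙ (∣-sub-trans v ρ r (∣ₙ⇒∣ q∣v-ρ') (∣-sub-sym r ρ (resid-congruent r (suc n) (λ ()))))
    where
    ρ = + (r %ℕ suc n)
    q∣v-ρ' : suc n ∣ₙ ∣ v - ρ ∣
    q∣v-ρ' = subst (λ t → suc n ∣ₙ ∣ v - + t ∣) (toℕ-fromℕ< _) q∣v-ρ

module SumsetGrowth {k : ℕ} (lam : Fin k → ℤ) (X : Fin k → List ℤ) (P : List ℤ) (M : ℤ)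
  {i j₀ : Fin k} (j₀≢i : j₀ ≢ i) (lam-j₀≢0 : lam j₀ ≢ + 0)
  (P⊆X : ∀ j {y} → y ∈ P → y ∈ X j) {y₀ : ℤ} (y₀∈P : y₀ ∈ P) {x : ℤ} (x∈X : x ∈ X i)
  (others-congruent : ∀ j → j ≢ i → ∀ {y y'} → y ∈ P → y' ∈ P → M ∣ lam j * y - lam j * y')
  (x-separated : ∀ {y} → y ∈ P → ¬ M ∣ lam i * x - lam i * y) where

  indices : List (Fin k)
  indices = allFin k

  unique-indices : Unique indices
  unique-indices = UniqueP.allFin⁺ k

  choice : ℤ → Fin k → ℤ
  choice y = upd (upd (λ _ → y₀) j₀ y) i x

  choice-i : ∀ y {j} → j ≡ i → choice y j ≡ x
  choice-i y refl = upd-eq _ i x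

  choice-j₀ : ∀ y → choice y j₀ ≡ y
  choice-j₀ y = trans (upd-neq _ i x j₀≢i) (upd-eq _ j₀ y)

  choice-other : ∀ y {j} → j ≢ i → j ≢ j₀ → choice y j ≡ y₀
  choice-other y j≢i j≢j₀ = trans (upd-neq _ i x j≢i) (upd-neq _ j₀ y j≢j₀)

  choice-fixed : ∀ y y' j → j ≢ j₀ → choice y j ≡ choice y' j
  choice-fixed y y' j j≢j₀ = by-cases (j Fin.≟ i)
    where
    by-cases : Dec (j ≡ i) → choice y j ≡ choice y' j
    by-cases (yes j≡i) = trans (choice-i y j≡i) (sym (choice-i y' j≡i))
    by-cases (no j≢i) = trans (choice-other y j≢i j≢j₀) (sym (choice-other y' j≢i j≢j₀))

  choice∈P : ∀ {y} → y ∈ P → ∀ j → j ≢ i → choice y j ∈ P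
  choice∈P {y} y∈P j j≢i = by-cases (j Fin.≟ j₀)
    where
    by-cases : Dec (j ≡ j₀) → choice y j ∈ P
    by-cases (yes refl) = subst (_∈ P) (sym (choice-j₀ y)) y∈P
    by-cases (no j≢j₀) = subst (_∈ P) (sym (choice-other y j≢i j≢j₀)) y₀∈P

  choice∈X : ∀ {y} → y ∈ P → ∀ j → choice y j ∈ X j
  choice∈X {y} y∈P j = by-cases (j Fin.≟ i)
    where
    by-cases : Dec (j ≡ i) → choice y j ∈ X j
    by-cases (yes refl) = subst (_∈ X i) (sym (choice-i y refl)) x∈X
    by-cases (no j≢i) = P⊆X j (choice∈P y∈P j j≢i)

  σ : ℤ → ℤ
  σ y = sumL (λ j → lam j * choice y j) indices

  -- σ y and σ y' differ only in the j₀-th term λⱼ₀ y vs λⱼ₀ y', and λⱼ₀ ≠ 0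
  σ-injective : ∀ {y y'} → σ y ≡ σ y' → y ≡ y'
  σ-injective {y} {y'} σy≡σy' =
    ℤP.*-cancelˡ-≡ (lam j₀) y y' {{ℤ.≢-nonZero lam-j₀≢0}} (ℤP.i-j≡0⇒i≡j _ _ j₀-terms)
    where
    other-terms : ∀ {j} → j ∈ indices → j ≢ j₀ → + 0 ∣ lam j * choice y j - lam j * choice y' j
    other-terms {j} _ j≢j₀ = ℤ∣.∣-reflexive (sym (ℤP.i≡j⇒i-j≡0 (cong (lam j *_) (choice-fixed y y' j j≢j₀))))
    j₀-terms : lam j₀ * y - lam j₀ * y' ≡ + 0
    j₀-terms = subst₂ (λ a b → lam j₀ * a - lam j₀ * b ≡ + 0) (choice-j₀ y) (choice-j₀ y')
      (ℤ∣.0∣⇒≡0 (equal-sums-congruent-at (+ 0) _ _ indices unique-indices (∈-allFin j₀) other-terms σy≡σy'))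

  -- modulo M an element of Σ λⱼ·P is determined by its i-th summand, and σ y has summand x there
  σ∉small : ∀ {y} → y ∈ P → σ y ∉ sumset lam (λ _ → P) indices
  σ∉small {y} y∈P σy∈ with d , d∈P , σy≡ ← sumset-∈⁻ lam (λ _ → P) indices unique-indices σy∈ =
    x-separated (d∈P (∈-allFin i))
      (subst (λ a → M ∣ lam i * a - lam i * d i) (choice-i y refl)
        (equal-sums-congruent-at M _ _ indices unique-indices (∈-allFin i) other-terms σy≡))
    where
    other-terms : ∀ {j} → j ∈ indices → j ≢ i → M ∣ lam j * choice y j - lam j * d j
    other-terms {j} j∈ j≢i = others-congruent j j≢i (choice∈P y∈P j j≢i) (d∈P j∈)

  small⊆large : ∀ {z} → z ∈ sumset lam (λ _ → P) indices → z ∈ sumset lam X indices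
  small⊆large z∈ with d , d∈P , refl ← sumset-∈⁻ lam (λ _ → P) indices unique-indices z∈ =
    sumset-∈⁺ lam X d indices (λ {j} j∈ → P⊆X j (d∈P j∈))

  σ∈large : ∀ {y} → y ∈ P → σ y ∈ sumset lam X indices
  σ∈large y∈P = sumset-∈⁺ lam X (choice _) indices (λ {j} _ → choice∈X y∈P j)

  bound : card (sumset lam X indices) ≥ card (sumset lam (λ _ → P) indices) ℕ.+ card P
  bound = card-disjoint-image _ _ P σ σ-injective small⊆large σ∈large σ∉small

classOf-∈⁻ : ∀ q r A {z} → z ∈ classOf q r A → z ∈ A × + q ∣ z - r
classOf-∈⁻ q r A z∈ with z∈A , q∣ ← ∈-filter⁻ (λ x → q ∣? ∣ x - r ∣) {xs = A} z∈ = z∈A , ∣ₙ⇒∣ q∣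

classOf-∈⁺ : ∀ q r A {z} → z ∈ A → + q ∣ z - r → z ∈ classOf q r A
classOf-∈⁺ q r A z∈A q∣ = ∈-filter⁺ (λ x → q ∣? ∣ x - r ∣) z∈A (∣⇒∣ₙ q∣)

classOf-⊆ : ∀ {q q'} r A {z} → q ∣ₙ q' → z ∈ classOf q' r A → z ∈ classOf q r A
classOf-⊆ {q} {q'} r A q∣q' z∈ with z∈A , q'∣ ← classOf-∈⁻ q' r A z∈ =
  classOf-∈⁺ q r A z∈A (ℤ∣.∣-trans (∣ₙ⇒∣ q∣q') q'∣)

another-index : ∀ {k} → k ≥ 2 → (i : Fin k) → ∃ λ j → j ≢ i
another-index {suc zero} (ℕ.s≤s ()) Fin.zero
another-index {suc (suc _)} _ Fin.zero = Fin.suc Fin.zero , λ ()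
another-index {suc (suc _)} _ (Fin.suc _) = Fin.zero , λ ()

module Setting (k : ℕ) (k≥2 : k ≥ 2) (lam : Fin k → ℤ) (lam≢0 : ∀ i → lam i ≢ + 0)
  (gcd≡1 : gcdList (map lam (allFin k)) ≡ 1) (A : List ℤ) (pₑ : ℤ) where

  g : Fin k → ℕ
  g = gᵢ lam

  p : ℕ
  p = pOf lam

  G : Fin k → List ℤ
  G i = classOf (g i) pₑ A

  P : List ℤ
  P = classOf p pₑ A

  P' : List ℤ
  P' = primeOf p pₑ P

  g∣λ : ∀ i j → j ≢ i → g i ∣ₙ ∣ lam j ∣
  g∣λ i j j≢i = gcdList-∣ _ (∈-map⁺ lam (∈-filter⁺ (λ j' → ¬? (j' Fin.≟ i)) (∈-allFin j) j≢i))

  λ-coprime : ∀ d → (∀ j → d ∣ₙ ∣ lam j ∣) → d ≡ 1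
  λ-coprime d d∣λ = ℕ∣.∣1⇒≡1 (subst (d ∣ₙ_) gcd≡1 (∣-gcdList d _ d∣each))
    where
    d∣each : ∀ {z} → z ∈ map lam (allFin k) → d ∣ₙ ∣ z ∣
    d∣each z∈ with j , _ , refl ← ∈-map⁻ lam z∈ = d∣λ j

  -- a common divisor of gᵢ and λᵢ divides every λⱼ
  g-coprime-λ : ∀ i → Coprime (g i) ∣ lam i ∣
  g-coprime-λ i {d} (d∣gᵢ , d∣λᵢ) = λ-coprime d d∣λ
    where
    d∣λ : ∀ j → d ∣ₙ ∣ lam j ∣
    d∣λ j with j Fin.≟ i
    ... | yes refl = d∣λᵢ
    ... | no j≢i = ℕ∣.∣-trans d∣gᵢ (g∣λ i j j≢i)

  -- a common divisor of gᵢ and gⱼ divides gⱼ, which divides λᵢ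
  g-coprime : ∀ i {j} → j ≢ i → Coprime (g i) (g j)
  g-coprime i {j} j≢i (d∣gᵢ , d∣gⱼ) = g-coprime-λ i (d∣gᵢ , ℕ∣.∣-trans d∣gⱼ (g∣λ j i (j≢i ∘ sym)))

  -- gᵢ ≠ 0 since it divides some λⱼ ≠ 0 (k ≥ 2)
  g≢0 : ∀ i → g i ≢ 0
  g≢0 i gᵢ≡0 with j , j≢i ← another-index k≥2 i =
    lam≢0 j (ℤP.∣i∣≡0⇒i≡0 (ℕ∣.0∣⇒≡0 (subst (_∣ₙ ∣ lam j ∣) gᵢ≡0 (g∣λ i j j≢i))))

  p≢0 : p ≢ 0
  p≢0 = prodL≢0 g (allFin k) g≢0

  p-factor : ∀ i → ∃ λ Q → p ≡ g i ℕ.* Q × Coprime (g i) Q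
  p-factor i = prodL-split g (allFin k) (UniqueP.allFin⁺ k) (∈-allFin i) (g-coprime i)

  P⊆G : ∀ j {y} → y ∈ P → y ∈ G j
  P⊆G j = classOf-⊆ pₑ A (∣-prodL g (∈-allFin j))

  P-congruent : ∀ {y} → y ∈ P → + p ∣ y - pₑ
  P-congruent = proj₂ ∘ classOf-∈⁻ p pₑ A

  P-terms-congruent : ∀ i j → j ≢ i → ∀ {y y'} → y ∈ P → y' ∈ P →
    + g i * + g i ∣ lam j * y - lam j * y'
  P-terms-congruent i j j≢i {y} {y'} y∈P y'∈P =
    subst (_ ∣_) (distrib (lam j) y y') (square-∣-product (lam j) (y - y') (∣ₙ⇒∣ (g∣λ i j j≢i)) gᵢ∣y-y')
    where
    gᵢ∣y-y' : + g i ∣ y - y'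
    gᵢ∣y-y' = ℤ∣.∣-trans (∣ₙ⇒∣ (∣-prodL g (∈-allFin i)))
                (∣-sub-trans y pₑ y' (P-congruent y∈P) (∣-sub-sym y' pₑ (P-congruent y'∈P)))
    distrib : ∀ a b c → a * (b - c) ≡ a * b - a * c
    distrib = solve-∀

  -- In coordinates: let p = gᵢ Q, and let t, s be the coordinates of pₑ modulo gᵢ and p.  If the
  -- coordinate of x ∈ Gᵢ is ≡ t + Q (r − s) (mod gᵢ), then gᵢ² ∣ λᵢ (x − y) with y ∈ P forces
  -- the coordinate of y into the class r modulo gᵢ.
  separation-criterion : ∀ i {Q} → p ≡ g i ℕ.* Q → Coprime (g i) Q → ∀ r {x} → x ∈ G i →
    + g i ∣ coord (g i) pₑ x - (coord (g i) pₑ pₑ + + Q * (r - coord p pₑ pₑ)) →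
    ∀ {y} → y ∈ P → + g i * + g i ∣ lam i * x - lam i * y → + g i ∣ coord p pₑ y - r
  separation-criterion i {Q} p≡gQ copQ r {x} x∈G u≡target {y} y∈P g²∣ =
    square-separation (lam i) w r v (g≢0 i) (g-coprime-λ i) copQ
      (subst (+ γ ∣_) (shift u t v s (+ Q) r) u≡target) (subst (_ ∣_) λ[x-y] g²∣)
    where
    γ = g i
    u = coord γ pₑ x
    t = coord γ pₑ pₑ
    v = coord p pₑ y
    s = coord p pₑ pₑ
    w = (u - t) - + Q * (v - s)
    x-pₑ : x - pₑ ≡ (u - t) * + γ
    x-pₑ = coord-difference γ pₑ x (g≢0 i) (proj₂ (classOf-∈⁻ γ pₑ A x∈G))
    y-pₑ : y - pₑ ≡ (v - s) * (+ γ * + Q)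
    y-pₑ = trans (coord-difference p pₑ y p≢0 (P-congruent y∈P))
                 (cong ((v - s) *_) (trans (cong +_ p≡gQ) (ℤP.pos-* γ Q)))
    λ[x-y] : lam i * x - lam i * y ≡ lam i * (w * + γ)
    λ[x-y] = begin
      lam i * x - lam i * y                            ≡⟨ via-pₑ (lam i) x y pₑ ⟩
      lam i * ((x - pₑ) - (y - pₑ))                    ≡⟨ cong (lam i *_) (cong₂ _-_ x-pₑ y-pₑ) ⟩
      lam i * ((u - t) * + γ - (v - s) * (+ γ * + Q))  ≡⟨ cong (lam i *_) (factor (u - t) (v - s) (+ γ) (+ Q)) ⟩
      lam i * (w * + γ)                                ∎
      where
      via-pₑ : ∀ l a b c → l * a - l * b ≡ l * ((a - c) - (b - c))
      via-pₑ = solve-∀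
      factor : ∀ a b c d → a * c - b * (c * d) ≡ (a - d * b) * c
      factor = solve-∀
    shift : ∀ u t v s Q r → u - (t + Q * (r - s)) ≡ ((u - t) - Q * (v - s)) - Q * (r - v)
    shift = solve-∀

  separated-point : ∀ i r → (∀ {v} → v ∈ P' → ¬ + g i ∣ v - r) →
    FullyDistributed (g i) (primeOf (g i) pₑ (G i)) →
    ∃ λ x → x ∈ G i × ∀ {y} → y ∈ P → ¬ + g i * + g i ∣ lam i * x - lam i * y
  separated-point i r r-missed G'-fd
    with Q , p≡gQ , copQ ← p-factor i
    with _ , u∈G' , u≡target ← G'-fd (coord (g i) pₑ pₑ + + Q * (r - coord p pₑ pₑ))
    with x , x∈G , refl ← ∈-map⁻ (coord (g i) pₑ) u∈G'
    = x , x∈G , λ y∈P g²∣ → r-missed (∈-map⁺ (coord p pₑ) y∈P)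
                              (separation-criterion i p≡gQ copQ r x∈G (∣ₙ⇒∣ u≡target) y∈P g²∣)

lemma2p4 : (k : ℕ) → k ≥ 2 → (lam : Fin k → ℤ) → (∀ i → lam i ≢ + 0) →
    gcdList (map lam (allFin k)) ≡ 1 →
    (A : List ℤ) → Reduced A →
    (pₑ : ℤ) → + 0 ℤ.≤ pₑ → pₑ < + (pOf lam) →
    (∃ λ x → x ∈ A × x ≡[mod pOf lam ] pₑ) →
    (∀ i → FullyDistributed (gᵢ lam i) (primeOf (gᵢ lam i) pₑ (classOf (gᵢ lam i) pₑ A))) →
    (∀ i → FullyDistributed (gᵢ lam i) (primeOf (pOf lam) pₑ (classOf (pOf lam) pₑ A)))
    ⊎ (card (bigSum (map (λ i → lam i · classOf (gᵢ lam i) pₑ A) (allFin k)))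
    ≥ card (bigSum (map (λ i → lam i · classOf (pOf lam) pₑ A) (allFin k)))
    Data.Nat.+ card (classOf (pOf lam) pₑ A))
lemma2p4 k k≥2 lam lam≢0 gcd≡1 A _ pₑ _ _ (y₀ , y₀∈A , y₀≡pₑ) G'-fd =
  Sum.map₂ growth (all-or-witness (λ i → fd-dichotomy (g i) P' (g≢0 i)))
  where
  open Setting k k≥2 lam lam≢0 gcd≡1 A pₑ
  growth : (∃ λ i → ∃ λ r → ∀ {v} → v ∈ P' → ¬ + g i ∣ v - r) →
    card (sumset lam G (allFin k)) ≥ card (sumset lam (λ _ → P) (allFin k)) ℕ.+ card P
  growth (i , r , r-missed)
    with x , x∈G , x-separated ← separated-point i r r-missed (G'-fd i)
    with j₀ , j₀≢i ← another-index k≥2 i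
    = SumsetGrowth.bound lam G P (+ g i * + g i) j₀≢i (lam≢0 j₀) P⊆G
        (classOf-∈⁺ p pₑ A y₀∈A (∣ₙ⇒∣ y₀≡pₑ)) x∈G (P-terms-congruent i) x-separated
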